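{- Let $r\geq 1$ be an integer and let $p\geq q$ be positive integers. Let $G$ be a bipartite graph with bipartition $(X,Y)$, $|X|=p$, $|Y|=q$, without isolated vertices, such that $b(G)<\frac{1}{r}$. Then: (i) If $p\geq rq+1$, then $e(G)\leq pq$, with equality if and only if $G\cong K_{p,q}$. (ii) If $r(q-1)+2\leq p\leq rq$, then $e(G)\leq pq-r(q-1)-1$, with equality if and only if $G\cong D(p-r(q-1)-1,\,r(q-1)+1;\,q-1,\,1)$. (iii) If $p\leq r(q-1)+1$, then $e(G)\leq pq-(r+1)(q-1)$, with equality if and only if $G\cong D(p-r-1,\,r+1;\,1,\,q-1)$.
   Context: Graphs are finite and simple; $e(G)$ is the number of edges. For $S\subseteq V(G)$, $N_G(S)$ is the union of neighborhoods of vertices in $S$; the binding number is $b(G)=\min\{|N_G(S)|/|S|:\emptyset\neq S\subseteq V(G),\ N_G(S)\neq V(G)\}$. $K_{p,q}$ is the complete bipartite graph. For integers $p_1,p_2,q_1,q_2$, $D(p_1,p_2;q_1,q_2)$ denotes the bipartite graph with parts $X=X_1\cup X_2$, $Y=Y_1\cup Y_2$ (disjoint independent sets, $|X_i|=p_i$, $|Y_i|=q_i$) in which every vertex of $X_1$ is adjacent to all of $Y_1\cup Y_2$, every vertex of $X_2$ is adjacent to all of $Y_1$, and there are no other edges. -}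

module Defs where

open import Data.Nat using (ℕ; zero; suc; _+_; _*_; _∸_; _≤_; _<_)
open import Data.Bool using (Bool; true; false; _∧_; _∨_; if_then_else_)
open import Data.Fin using (Fin; splitAt)
open import Data.Sum using (_⊎_; inj₁; inj₂)
open import Data.Product using (Σ; ∃; _×_; _,_)
open import Relation.Binary.PropositionalEquality using (_≡_)
open import Relation.Nullary using (¬_)
open import Function.Bundles using (_↔_; Inverse)

sumFin : {n : ℕ} → (Fin n → ℕ) → ℕ
sumFin {zero}  f = 0
sumFin {suc n} f = f Data.Fin.zero + sumFin (λ i → f (Data.Fin.suc i))

b2n : Bool → ℕ
b2n true  = 1
b2n false = 0

count : {n : ℕ} → (Fin n → Bool) → ℕ
count f = sumFin (λ i → b2n (f i))

anyFin : {n : ℕ} → (Fin n → Bool) → Bool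
anyFin {zero}  f = false
anyFin {suc n} f = f Data.Fin.zero ∨ anyFin (λ i → f (Data.Fin.suc i))

-- A finite simple bipartite graph G with bipartition (X , Y), |X| = p,
-- |Y| = q, given by its biadjacency relation: B x y ≡ true iff xy ∈ E(G).
Bip : ℕ → ℕ → Set
Bip p q = Fin p → Fin q → Bool

V : ℕ → ℕ → Set
V p q = Fin p ⊎ Fin q

Adj : {p q : ℕ} → Bip p q → V p q → V p q → Bool
Adj B (inj₁ x) (inj₂ y) = B x y
Adj B (inj₂ y) (inj₁ x) = B x y
Adj B (inj₁ _) (inj₁ _) = false
Adj B (inj₂ _) (inj₂ _) = false

edges : {p q : ℕ} → Bip p q → ℕ
edges B = sumFin (λ x → count (λ y → B x y))

NoIsolated : {p q : ℕ} → Bip p q → Set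
NoIsolated {p} {q} B =
  ((x : Fin p) → ∃ λ y → B x y ≡ true) × ((y : Fin q) → ∃ λ x → B x y ≡ true)

VSubset : ℕ → ℕ → Set
VSubset p q = V p q → Bool

size : {p q : ℕ} → VSubset p q → ℕ
size S = count (λ x → S (inj₁ x)) + count (λ y → S (inj₂ y))

nbhd : {p q : ℕ} → Bip p q → VSubset p q → VSubset p q
nbhd B S v = anyFin (λ x → S (inj₁ x) ∧ Adj B (inj₁ x) v)
           ∨ anyFin (λ y → S (inj₂ y) ∧ Adj B (inj₂ y) v)

-- S is admissible in the definition of b(G): S ≠ ∅ and N_G(S) ≠ V(G).
Admissible : {p q : ℕ} → Bip p q → VSubset p q → Set
Admissible B S = (∃ λ v → S v ≡ true) × (∃ λ v → nbhd B S v ≡ false)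

-- b(G) < 1/r.  Since b(G) is the minimum of |N_G(S)|/|S| over the finitely
-- many admissible S, b(G) < 1/r iff some admissible S has
-- |N_G(S)|/|S| < 1/r, i.e. r·|N_G(S)| < |S| (|S| > 0).
BindingLessThanInv : {p q : ℕ} → Bip p q → ℕ → Set
BindingLessThanInv B r =
  ∃ λ S → Admissible B S × (r * size (nbhd B S) < size S)

-- Isomorphism (of graphs, not necessarily preserving the sides)

_≅_ : {p q p' q' : ℕ} → Bip p q → Bip p' q' → Set
_≅_ {p} {q} {p'} {q'} G H =
  Σ (V p q ↔ V p' q') λ f →
    (u v : V p q) → Adj G u v ≡ Adj H (Inverse.to f u) (Inverse.to f v)

K : (p q : ℕ) → Bip p q
K p q _ _ = true

-- D(p₁,p₂;q₁,q₂): X = X₁ ∪ X₂ = Fin (p₁ + p₂) (first p₁ indices form X₁),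
-- Y = Y₁ ∪ Y₂ = Fin (q₁ + q₂) (first q₁ indices form Y₁); X₁ is complete to
-- Y, X₂ is complete to Y₁, no other edges.
inFirst : (m : ℕ) {n : ℕ} → Fin (m + n) → Bool
inFirst m i with splitAt m i
... | inj₁ _ = true
... | inj₂ _ = false

D : (p₁ p₂ q₁ q₂ : ℕ) → Bip (p₁ + p₂) (q₁ + q₂)
D p₁ p₂ q₁ q₂ x y = inFirst p₁ x ∨ inFirst q₁ y

{-# OPTIONS --safe #-}
-- A set S with r·|N(S)| < |S| can be split along the bipartition: N(S ∩ X) ⊆ Y and N(S ∩ Y) ⊆ X
-- are disjoint, so S ∩ X or S ∩ Y already satisfies the inequality, and after transposing G we may
-- take S ⊆ X.  Every vertex of S is adjacent only to T = N(S), so e(G) ≤ pq − |S|·|Y ∖ T|, with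
-- equality exactly when S is complete to T and X ∖ S is complete to Y, i.e. when
-- G ≅ D(|X ∖ S|, |S|, |T|, |Y ∖ T|).  What remains is arithmetic: minimise |S|·|Y ∖ T| subject to
-- r·|T| < |S|, |T| ≥ 1 and the range of p, and read off the parameters where the minimum is
-- attained.  Part (i) only needs e(G) ≤ pq.

module Submission where

open import Defs
open import Data.Nat using (ℕ; zero; suc; _+_; _*_; _∸_; _≤_; _<_; z≤n; s≤s; _<?_; >-nonZero)
open import Data.Nat.Properties
open import Data.Nat.Tactic.RingSolver using (solve-∀)
open import Data.Bool using (Bool; true; false; _∧_; _∨_; not)
open import Data.Bool.Properties using (not-involutive; ∨-comm; ∨-zeroʳ; ∧-zeroʳ; ∨-identityʳ)
open import Data.Fin using (Fin; splitAt; join; _↑ˡ_; _↑ʳ_)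
import Data.Fin as Fin
open import Data.Fin.Properties using (+↔⊎; splitAt-↑ˡ; splitAt-↑ʳ; splitAt-join)
open import Data.Fin.Permutation using (↔⇒≡)
open import Data.Sum using (_⊎_; inj₁; inj₂; [_,_]′; swap)
import Data.Sum as Sum
open import Data.Sum.Algebra using (⊎-cong; ⊎-comm; ⊎-assoc)
open import Level using (0ℓ)
open import Data.Product using (Σ-syntax; ∃; _×_; _,_; proj₁; proj₂)
import Data.Product as Product
open import Data.Empty using (⊥; ⊥-elim)
open import Function using (_∘_)
open import Function.Bundles using (_↔_; _⇔_; Inverse; mk↔ₛ′; mk⇔)
open import Function.Construct.Composition using (_↔-∘_)
open import Function.Properties.Inverse using (↔-refl; ↔-sym)
open import Relation.Binary.PropositionalEquality
open import Relation.Nullary using (yes; no)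
import Algebra.Properties.CommutativeMonoid.Sum as CommutativeMonoidSum

private module ∑ = CommutativeMonoidSum +-0-commutativeMonoid

open Inverse using (to)

sumFin≡sum : ∀ {n} (f : Fin n → ℕ) → sumFin f ≡ ∑.sum f
sumFin≡sum {zero}  f = refl
sumFin≡sum {suc n} f = cong (f Fin.zero +_) (sumFin≡sum (f ∘ Fin.suc))

sumFin-cong : ∀ {n} {f g : Fin n → ℕ} → (∀ i → f i ≡ g i) → sumFin f ≡ sumFin g
sumFin-cong {zero}  f≗g = refl
sumFin-cong {suc n} f≗g = cong₂ _+_ (f≗g Fin.zero) (sumFin-cong (f≗g ∘ Fin.suc))

sumFin-mono-≤ : ∀ {n} {f g : Fin n → ℕ} → (∀ i → f i ≤ g i) → sumFin f ≤ sumFin g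
sumFin-mono-≤ {zero}  f≤g = z≤n
sumFin-mono-≤ {suc n} f≤g = +-mono-≤ (f≤g Fin.zero) (sumFin-mono-≤ (f≤g ∘ Fin.suc))

+-mono-≤-≡ : ∀ {a b c d} → a ≤ c → b ≤ d → a + b ≡ c + d → a ≡ c × b ≡ d
+-mono-≤-≡ {a} {b} {c} {d} a≤c b≤d a+b≡c+d = a≡c , +-cancelˡ-≡ a b d (trans a+b≡c+d (cong (_+ d) (sym a≡c)))
  where
  a≡c : a ≡ c
  a≡c = ≤-antisym a≤c (+-cancelʳ-≤ b c a (≤-trans (+-monoʳ-≤ c b≤d) (≤-reflexive (sym a+b≡c+d))))

sumFin-mono-≤-≡ : ∀ {n} {f g : Fin n → ℕ} → (∀ i → f i ≤ g i) → sumFin f ≡ sumFin g → ∀ i → f i ≡ g i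
sumFin-mono-≤-≡ {suc n} f≤g ∑f≡∑g with +-mono-≤-≡ (f≤g Fin.zero) (sumFin-mono-≤ (f≤g ∘ Fin.suc)) ∑f≡∑g
... | f0≡g0 , ∑f′≡∑g′ = λ where
  Fin.zero    → f0≡g0
  (Fin.suc i) → sumFin-mono-≤-≡ (f≤g ∘ Fin.suc) ∑f′≡∑g′ i

sumFin-const : ∀ n c → sumFin {n} (λ _ → c) ≡ n * c
sumFin-const zero    c = refl
sumFin-const (suc n) c = cong (c +_) (sumFin-const n c)

sumFin-distrib-+ : ∀ {n} (f g : Fin n → ℕ) → sumFin (λ i → f i + g i) ≡ sumFin f + sumFin g
sumFin-distrib-+ f g = begin
  sumFin (λ i → f i + g i)   ≡⟨ sumFin≡sum (λ i → f i + g i) ⟩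
  ∑.sum (λ i → f i + g i)    ≡⟨ ∑.∑-distrib-+ f g ⟩
  ∑.sum f + ∑.sum g          ≡⟨ cong₂ _+_ (sumFin≡sum f) (sumFin≡sum g) ⟨
  sumFin f + sumFin g        ∎
  where open ≡-Reasoning

sumFin-distribʳ-* : ∀ {n} (f : Fin n → ℕ) c → sumFin (λ i → f i * c) ≡ sumFin f * c
sumFin-distribʳ-* {zero}  f c = refl
sumFin-distribʳ-* {suc n} f c = trans (cong (f Fin.zero * c +_) (sumFin-distribʳ-* (f ∘ Fin.suc) c))
                                      (sym (*-distribʳ-+ c (f Fin.zero) (sumFin (f ∘ Fin.suc))))

sumFin-comm : ∀ {m n} (f : Fin m → Fin n → ℕ) →
              sumFin (λ i → sumFin (f i)) ≡ sumFin (λ j → sumFin (λ i → f i j))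
sumFin-comm f = begin
  sumFin (λ i → sumFin (f i))          ≡⟨ sumFin≡sum₂ f ⟩
  ∑.sum (λ i → ∑.sum (f i))            ≡⟨ ∑.∑-comm f ⟩
  ∑.sum (λ j → ∑.sum (λ i → f i j))    ≡⟨ sumFin≡sum₂ (λ j i → f i j) ⟨
  sumFin (λ j → sumFin (λ i → f i j))  ∎
  where
  open ≡-Reasoning
  sumFin≡sum₂ : ∀ {m n} (g : Fin m → Fin n → ℕ) →
                sumFin (λ i → sumFin (g i)) ≡ ∑.sum (λ i → ∑.sum (g i))
  sumFin≡sum₂ g = trans (sumFin-cong (sumFin≡sum ∘ g)) (sumFin≡sum (λ i → ∑.sum (g i)))

sumFin-permute : ∀ {m n} (f : Fin n → ℕ) (π : Fin m ↔ Fin n) → sumFin f ≡ sumFin (f ∘ to π)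
sumFin-permute f π = trans (sumFin≡sum f) (trans (∑.∑-permute f π) (sym (sumFin≡sum (f ∘ to π))))

sumFin-++ : ∀ m {n} (f : Fin (m + n) → ℕ) →
            sumFin f ≡ sumFin (λ i → f (i ↑ˡ n)) + sumFin (λ j → f (m ↑ʳ j))
sumFin-++ zero    f = refl
sumFin-++ (suc m) f = trans (cong (f Fin.zero +_) (sumFin-++ m (f ∘ Fin.suc))) (sym (+-assoc (f Fin.zero) _ _))

b2n-mono : ∀ {a b} → (a ≡ true → b ≡ true) → b2n a ≤ b2n b
b2n-mono {true}  a⇒b rewrite a⇒b refl = ≤-refl
b2n-mono {false} a⇒b = z≤n

b2n-injective : ∀ {a b} → b2n a ≡ b2n b → a ≡ b
b2n-injective {true}  {true}  _ = refl
b2n-injective {false} {false} _ = refl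

b2n+b2n-not : ∀ b → b2n b + b2n (not b) ≡ 1
b2n+b2n-not true  = refl
b2n+b2n-not false = refl

count-cong : ∀ {n} {f g : Fin n → Bool} → (∀ i → f i ≡ g i) → count f ≡ count g
count-cong f≗g = sumFin-cong (cong b2n ∘ f≗g)

count-const : ∀ n b → count {n} (λ _ → b) ≡ n * b2n b
count-const n b = sumFin-const n (b2n b)

count-true : ∀ n → count {n} (λ _ → true) ≡ n
count-true n = trans (count-const n true) (*-identityʳ n)

count-false : ∀ n → count {n} (λ _ → false) ≡ 0
count-false n = trans (count-const n false) (*-zeroʳ n)

count-mono : ∀ {n} {f g : Fin n → Bool} → (∀ i → f i ≡ true → g i ≡ true) → count f ≤ count g
count-mono f⇒g = sumFin-mono-≤ (b2n-mono ∘ f⇒g)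

count-mono-≡ : ∀ {n} {f g : Fin n → Bool} → (∀ i → f i ≡ true → g i ≡ true) →
               count f ≡ count g → ∀ i → f i ≡ g i
count-mono-≡ f⇒g #f≡#g i = b2n-injective (sumFin-mono-≤-≡ (b2n-mono ∘ f⇒g) #f≡#g i)

count≤n : ∀ {n} (f : Fin n → Bool) → count f ≤ n
count≤n {n} f = subst (count f ≤_) (count-true n) (count-mono {f = f} {λ _ → true} λ _ _ → refl)

count≡n⇒true : ∀ {n} (f : Fin n → Bool) → count f ≡ n → ∀ i → f i ≡ true
count≡n⇒true {n} f #f≡n = count-mono-≡ (λ _ _ → refl) (trans #f≡n (sym (count-true n)))

count+count-not : ∀ {n} (f : Fin n → Bool) → count f + count (not ∘ f) ≡ n
count+count-not {n} f = begin
  count f + count (not ∘ f)                   ≡⟨ sumFin-distrib-+ (b2n ∘ f) (b2n ∘ not ∘ f) ⟨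
  sumFin (λ i → b2n (f i) + b2n (not (f i)))  ≡⟨ sumFin-cong (b2n+b2n-not ∘ f) ⟩
  sumFin {n} (λ _ → 1)                        ≡⟨ count-true n ⟩
  n                                           ∎
  where open ≡-Reasoning

count-not-not : ∀ {n} (f : Fin n → Bool) → count (not ∘ not ∘ f) ≡ count f
count-not-not f = count-cong (not-involutive ∘ f)

true⇒count≥1 : ∀ {n} (f : Fin n → Bool) i → f i ≡ true → 1 ≤ count f
true⇒count≥1 f Fin.zero    fi≡true rewrite fi≡true = s≤s z≤n
true⇒count≥1 f (Fin.suc i) fi≡true =
  ≤-trans (true⇒count≥1 (f ∘ Fin.suc) i fi≡true) (m≤n+m (count (f ∘ Fin.suc)) (b2n (f Fin.zero)))

count≥1⇒true : ∀ {n} (f : Fin n → Bool) → 1 ≤ count f → ∃ λ i → f i ≡ true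
count≥1⇒true {suc n} f #f≥1 with f Fin.zero in f0≡b
... | true  = Fin.zero , f0≡b
... | false = let i , fi≡true = count≥1⇒true (f ∘ Fin.suc) #f≥1 in Fin.suc i , fi≡true

anyFin-true : ∀ {n} (f : Fin n → Bool) i → f i ≡ true → anyFin f ≡ true
anyFin-true f Fin.zero    fi≡true rewrite fi≡true = refl
anyFin-true f (Fin.suc i) fi≡true rewrite anyFin-true (f ∘ Fin.suc) i fi≡true = ∨-zeroʳ (f Fin.zero)

anyFin-false : ∀ {n} (f : Fin n → Bool) → (∀ i → f i ≡ false) → anyFin f ≡ false
anyFin-false {zero}  f f≡false = refl
anyFin-false {suc n} f f≡false rewrite f≡false Fin.zero =
  anyFin-false (f ∘ Fin.suc) (f≡false ∘ Fin.suc)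

isInj₁ : {A B : Set} → A ⊎ B → Bool
isInj₁ (inj₁ _) = true
isInj₁ (inj₂ _) = false

inFirst≡isInj₁ : ∀ m {n} (i : Fin (m + n)) → inFirst m i ≡ isInj₁ (splitAt m i)
inFirst≡isInj₁ m i with splitAt m i
... | inj₁ _ = refl
... | inj₂ _ = refl

inFirst-↑ˡ : ∀ m n (i : Fin m) → inFirst m (i ↑ˡ n) ≡ true
inFirst-↑ˡ m n i = trans (inFirst≡isInj₁ m (i ↑ˡ n)) (cong isInj₁ (splitAt-↑ˡ m i n))

inFirst-↑ʳ : ∀ m n (j : Fin n) → inFirst m (m ↑ʳ j) ≡ false
inFirst-↑ʳ m n j = trans (inFirst≡isInj₁ m (m ↑ʳ j)) (cong isInj₁ (splitAt-↑ʳ m n j))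

count-inFirst : ∀ m n → count (inFirst m {n}) ≡ m
count-inFirst m n = begin
  count (inFirst m {n})
    ≡⟨ sumFin-++ m (b2n ∘ inFirst m) ⟩
  count (λ i → inFirst m (i ↑ˡ n)) + count (λ (j : Fin n) → inFirst m (m ↑ʳ j))
    ≡⟨ cong₂ _+_ (count-cong (inFirst-↑ˡ m n)) (count-cong (inFirst-↑ʳ m n)) ⟩
  count {m} (λ _ → true) + count {n} (λ _ → false)
    ≡⟨ cong₂ _+_ (count-true m) (count-false n) ⟩
  m + 0
    ≡⟨ +-identityʳ m ⟩
  m ∎
  where open ≡-Reasoning

count-not-inFirst : ∀ m n → count (not ∘ inFirst m {n}) ≡ n
count-not-inFirst m n = +-cancelˡ-≡ m _ n (begin
  m + count (not ∘ inFirst m)                  ≡⟨ cong (_+ count (not ∘ inFirst m)) (count-inFirst m n) ⟨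
  count (inFirst m) + count (not ∘ inFirst m)  ≡⟨ count+count-not (inFirst m) ⟩
  m + n                                        ∎)
  where open ≡-Reasoning

isInj₁-swap : {A B : Set} (e : A ⊎ B) → isInj₁ (swap e) ≡ not (isInj₁ e)
isInj₁-swap (inj₁ _) = refl
isInj₁-swap (inj₂ _) = refl

extendˡ : ∀ {n k} {B : Set} → Fin n ↔ (Fin k ⊎ B) → Fin (suc n) ↔ (Fin (suc k) ⊎ B)
extendˡ g = ⊎-cong (↔-sym +↔⊎) ↔-refl ↔-∘ (↔-sym (⊎-assoc 0ℓ _ _ _) ↔-∘ (⊎-cong ↔-refl g ↔-∘ +↔⊎ {1}))

isInj₁-extendˡ : ∀ {n k} {B : Set} (g : Fin n ↔ (Fin k ⊎ B)) i →
                 isInj₁ (to (extendˡ g) (Fin.suc i)) ≡ isInj₁ (to g i)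
isInj₁-extendˡ g i with to g i
... | inj₁ _ = refl
... | inj₂ _ = refl

partition : ∀ {n} (P : Fin n → Bool) {k m} → count P ≡ k → count (not ∘ P) ≡ m →
            Σ[ f ∈ Fin n ↔ (Fin k ⊎ Fin m) ] (∀ i → isInj₁ (to f i) ≡ P i)
partition {zero} P refl refl =
  mk↔ₛ′ (λ ()) (λ { (inj₁ ()) ; (inj₂ ()) }) (λ { (inj₁ ()) ; (inj₂ ()) }) (λ ()) , λ ()
partition {suc n} P #P #¬P with P Fin.zero in P0
partition {suc n} P {zero}  () _ | true
partition {suc n} P {suc k} #P #¬P | true =
  let f , f-sorts = partition (P ∘ Fin.suc) (suc-injective #P) #¬P
  in extendˡ f , λ { Fin.zero → sym P0 ; (Fin.suc i) → trans (isInj₁-extendˡ f i) (f-sorts i) }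
partition {suc n} P {m = zero}  _ () | false
partition {suc n} P {m = suc m} #P #¬P | false =
  let f , f-sorts = partition (not ∘ P ∘ Fin.suc) (suc-injective #¬P) (trans (count-not-not (P ∘ Fin.suc)) #P)
  in ⊎-comm _ _ ↔-∘ extendˡ f , λ
    { Fin.zero    → sym P0
    ; (Fin.suc i) → trans (isInj₁-swap (to (extendˡ f) (Fin.suc i)))
                          (trans (cong not (trans (isInj₁-extendˡ f i) (f-sorts i)))
                                 (not-involutive (P (Fin.suc i)))) }

sortBy : ∀ {n} (P : Fin n → Bool) {k m} → count P ≡ k → count (not ∘ P) ≡ m →
         Σ[ f ∈ Fin n ↔ Fin (k + m) ] (∀ i → inFirst k (to f i) ≡ P i)
sortBy P {k} {m} #P #¬P =
  let f , f-sorts = partition P #P #¬P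
  in ↔-sym +↔⊎ ↔-∘ f , λ i → begin
       inFirst k (join k m (to f i))            ≡⟨ inFirst≡isInj₁ k (join k m (to f i)) ⟩
       isInj₁ (splitAt k (join k m (to f i)))   ≡⟨ cong isInj₁ (splitAt-join k m (to f i)) ⟩
       isInj₁ (to f i)                          ≡⟨ f-sorts i ⟩
       P i                                      ∎
  where open ≡-Reasoning

infix 30 _ᵀ
_ᵀ : ∀ {p q} → Bip p q → Bip q p
(G ᵀ) y x = G x y

relabel : ∀ {p q p′ q′} {G : Bip p q} {H : Bip p′ q′} (g : Fin p ↔ Fin p′) (h : Fin q ↔ Fin q′) →
          (∀ x y → G x y ≡ H (to g x) (to h y)) → G ≅ H
relabel {G = G} {H} g h G≡H = ⊎-cong g h , adj
  where
  adj : ∀ u v → Adj G u v ≡ Adj H (to (⊎-cong g h) u) (to (⊎-cong g h) v)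
  adj (inj₁ _) (inj₁ _) = refl
  adj (inj₁ x) (inj₂ y) = G≡H x y
  adj (inj₂ y) (inj₁ x) = G≡H x y
  adj (inj₂ _) (inj₂ _) = refl

≗⇒≅ : ∀ {p q} {G H : Bip p q} → (∀ x y → G x y ≡ H x y) → G ≅ H
≗⇒≅ = relabel ↔-refl ↔-refl

≅-trans : ∀ {p q p′ q′ p″ q″} {G : Bip p q} {H : Bip p′ q′} {L : Bip p″ q″} → G ≅ H → H ≅ L → G ≅ L
≅-trans (f , G≡H) (g , H≡L) = g ↔-∘ f , λ u v → trans (G≡H u v) (H≡L (to f u) (to f v))

≅-ᵀ : ∀ {p q} {G : Bip p q} → G ≅ G ᵀ
≅-ᵀ {G = G} = ⊎-comm _ _ , adj
  where
  adj : ∀ u v → Adj G u v ≡ Adj (G ᵀ) (swap u) (swap v)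
  adj (inj₁ _) (inj₁ _) = refl
  adj (inj₁ _) (inj₂ _) = refl
  adj (inj₂ _) (inj₁ _) = refl
  adj (inj₂ _) (inj₂ _) = refl

≅-D-cong : ∀ {p q a b c d a′ b′ c′ d′} {G : Bip p q} →
           G ≅ D a b c d → a ≡ a′ → b ≡ b′ → c ≡ c′ → d ≡ d′ → G ≅ D a′ b′ c′ d′
≅-D-cong G≅D refl refl refl refl = G≅D

D-swap : ∀ {a b c d} → D a b c d ≅ D c d a b
D-swap {a} {c = c} = ≅-trans ≅-ᵀ (≗⇒≅ λ y x → ∨-comm (inFirst a x) (inFirst c y))

∨-shaped⇒≅D : ∀ {p q} {G : Bip p q} {A : Fin p → Bool} {T : Fin q → Bool} →
              (∀ x y → G x y ≡ A x ∨ T y) → G ≅ D (count A) (count (not ∘ A)) (count T) (count (not ∘ T))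
∨-shaped⇒≅D {A = A} {T} G≡A∨T =
  let g , g-sorts = sortBy A refl refl
      h , h-sorts = sortBy T refl refl
  in relabel g h λ x y → trans (G≡A∨T x y) (sym (cong₂ _∨_ (g-sorts x) (h-sorts y)))

sumV : ∀ {p q} → (V p q → ℕ) → ℕ
sumV {p} f = sumFin (f ∘ splitAt p)

sumV-cong : ∀ {p q} {f g : V p q → ℕ} → (∀ v → f v ≡ g v) → sumV f ≡ sumV g
sumV-cong {p} f≗g = sumFin-cong (f≗g ∘ splitAt p)

sumV-split : ∀ {p q} (f : V p q → ℕ) → sumV f ≡ sumFin (f ∘ inj₁) + sumFin (f ∘ inj₂)
sumV-split {p} {q} f = trans (sumFin-++ p (f ∘ splitAt p))
  (cong₂ _+_ (sumFin-cong λ x → cong f (splitAt-↑ˡ p x q)) (sumFin-cong λ y → cong f (splitAt-↑ʳ p q y)))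

↔V⇒↔Fin : ∀ {p q p′ q′} → V p q ↔ V p′ q′ → Fin (p + q) ↔ Fin (p′ + q′)
↔V⇒↔Fin π = ↔-sym +↔⊎ ↔-∘ (π ↔-∘ +↔⊎)

sumV-permute : ∀ {p q p′ q′} (f : V p′ q′ → ℕ) (π : V p q ↔ V p′ q′) → sumV f ≡ sumV (f ∘ to π)
sumV-permute {p} {p′ = p′} {q′} f π = trans (sumFin-permute (f ∘ splitAt p′) (↔V⇒↔Fin π))
  (sumFin-cong λ i → cong f (splitAt-join p′ q′ (to π (splitAt p i))))

degreeSum : ∀ {p q} → Bip p q → ℕ
degreeSum G = sumV λ u → sumV λ v → b2n (Adj G u v)

degreeSum≡2*edges : ∀ {p q} (G : Bip p q) → degreeSum G ≡ 2 * edges G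
degreeSum≡2*edges {p} {q} G = begin
  degreeSum G
    ≡⟨ trans (sumV-split (sumV ∘ Adj′)) (cong₂ _+_ (sumFin-cong (sumV-split ∘ Adj′ ∘ inj₁))
                                                   (sumFin-cong (sumV-split ∘ Adj′ ∘ inj₂))) ⟩
  sumFin (λ x → count {p} (λ _ → false) + count (G x))
    + sumFin (λ y → count (λ x → G x y) + count {q} (λ _ → false))
    ≡⟨ cong₂ _+_ (sumFin-cong λ x → cong (_+ count (G x)) (count-false p))
                 (sumFin-cong λ y → trans (cong (count (λ x → G x y) +_) (count-false q)) (+-identityʳ _)) ⟩
  edges G + sumFin (λ y → count (λ x → G x y))
    ≡⟨ cong (edges G +_) (sumFin-comm λ x y → b2n (G x y)) ⟨
  edges G + edges G
    ≡⟨ cong (edges G +_) (+-identityʳ (edges G)) ⟨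
  2 * edges G
    ∎
  where
  open ≡-Reasoning
  Adj′ : V p q → V p q → ℕ
  Adj′ u v = b2n (Adj G u v)

≅⇒edges≡ : ∀ {p q p′ q′} {G : Bip p q} {H : Bip p′ q′} → G ≅ H → edges G ≡ edges H
≅⇒edges≡ {G = G} {H} (π , G≡H) = *-cancelˡ-≡ (edges G) (edges H) 2 (begin
  2 * edges G                                            ≡⟨ degreeSum≡2*edges G ⟨
  degreeSum G                                            ≡⟨ sumV-cong (λ u → sumV-cong λ v → cong b2n (G≡H u v)) ⟩
  sumV (λ u → sumV λ v → b2n (Adj H (to π u) (to π v)))  ≡⟨ sumV-cong (λ u → sumV-permute (b2n ∘ Adj H (to π u)) π) ⟨
  sumV (λ u → sumV λ v′ → b2n (Adj H (to π u) v′))        ≡⟨ sumV-permute (λ u′ → sumV λ v′ → b2n (Adj H u′ v′)) π ⟨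
  degreeSum H                                            ≡⟨ degreeSum≡2*edges H ⟩
  2 * edges H                                            ∎)
  where open ≡-Reasoning

≅⇒order≡ : ∀ {p q p′ q′} {G : Bip p q} {H : Bip p′ q′} → G ≅ H → p + q ≡ p′ + q′
≅⇒order≡ (π , _) = ↔⇒≡ (↔V⇒↔Fin π)

edges≤* : ∀ {p q} (G : Bip p q) → edges G ≤ p * q
edges≤* {p} {q} G = subst (edges G ≤_) (sumFin-const p q) (sumFin-mono-≤ (count≤n ∘ G))

edges≡*⇒complete : ∀ {p q} (G : Bip p q) → edges G ≡ p * q → ∀ x y → G x y ≡ true
edges≡*⇒complete {p} {q} G e≡pq x =
  count≡n⇒true (G x) (sumFin-mono-≤-≡ (count≤n ∘ G) (trans e≡pq (sym (sumFin-const p q))) x)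

edges≡*⇔≅K : ∀ {p q} (G : Bip p q) → (edges G ≡ p * q) ⇔ (G ≅ K p q)
edges≡*⇔≅K {p} {q} G = mk⇔
  (λ e≡pq → ≗⇒≅ (edges≡*⇒complete G e≡pq))
  (λ G≅K → trans (≅⇒edges≡ G≅K) (trans (sumFin-cong {p} λ _ → count-true q) (sumFin-const p q)))

edges-∨-shaped : ∀ {p q} {G : Bip p q} {A : Fin p → Bool} {T : Fin q → Bool} →
                 (∀ x y → G x y ≡ A x ∨ T y) → edges G ≡ count A * q + count (not ∘ A) * count T
edges-∨-shaped {p} {q} {G} {A} {T} G≡A∨T = begin
  edges G
    ≡⟨ sumFin-cong row ⟩
  sumFin (λ x → b2n (A x) * q + b2n (not (A x)) * count T)
    ≡⟨ sumFin-distrib-+ (λ x → b2n (A x) * q) (λ x → b2n (not (A x)) * count T) ⟩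
  sumFin (λ x → b2n (A x) * q) + sumFin (λ x → b2n (not (A x)) * count T)
    ≡⟨ cong₂ _+_ (sumFin-distribʳ-* (b2n ∘ A) q) (sumFin-distribʳ-* (b2n ∘ not ∘ A) (count T)) ⟩
  count A * q + count (not ∘ A) * count T ∎
  where
  open ≡-Reasoning
  row : ∀ x → count (G x) ≡ b2n (A x) * q + b2n (not (A x)) * count T
  row x with A x in Ax
  ... | true  = trans (count-cong λ y → trans (G≡A∨T x y) (cong (_∨ T y) Ax))
                      (trans (count-true q) (sym (trans (+-identityʳ _) (+-identityʳ q))))
  ... | false = trans (count-cong λ y → trans (G≡A∨T x y) (cong (_∨ T y) Ax)) (sym (+-identityʳ _))

edges-D : ∀ a b c d → edges (D a b c d) + b * d ≡ (a + b) * (c + d)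
edges-D a b c d = begin
  edges (D a b c d) + b * d
    ≡⟨ cong (_+ b * d) (edges-∨-shaped {G = D a b c d} λ _ _ → refl) ⟩
  count (inFirst a) * (c + d) + count (not ∘ inFirst a) * count (inFirst c) + b * d
    ≡⟨ cong (_+ b * d) (cong₂ _+_ (cong (_* (c + d)) (count-inFirst a b))
                                  (cong₂ _*_ (count-not-inFirst a b) (count-inFirst c d))) ⟩
  a * (c + d) + b * c + b * d
    ≡⟨ collect a b c d ⟩
  (a + b) * (c + d) ∎
  where
  open ≡-Reasoning
  collect : ∀ a b c d → a * (c + d) + b * c + b * d ≡ (a + b) * (c + d)
  collect = solve-∀

≅D⇒edges : ∀ {p q} {G : Bip p q} a b c d → G ≅ D a b c d → c + d ≡ q → edges G ≡ p * q ∸ b * d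
≅D⇒edges {p} {G = G} a b c d G≅D refl with +-cancelʳ-≡ (c + d) p (a + b) (≅⇒order≡ G≅D)
... | refl = begin
  edges G                          ≡⟨ ≅⇒edges≡ G≅D ⟩
  edges (D a b c d)                ≡⟨ m+n∸n≡m (edges (D a b c d)) (b * d) ⟨
  edges (D a b c d) + b * d ∸ b * d ≡⟨ cong (_∸ b * d) (edges-D a b c d) ⟩
  (a + b) * (c + d) ∸ b * d        ∎
  where open ≡-Reasoning

edges-ᵀ : ∀ {p q} (G : Bip p q) → edges (G ᵀ) ≡ edges G
edges-ᵀ G = sym (sumFin-comm λ x y → b2n (G x y))

-- The deficiency of a neighbourhood

record Slack (e N K : ℕ) (Extremal : Set) : Set where
  field
    slack   : ℕ
    bound   : e + slack ≤ N
    minimal : K ≤ slack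
    tight   : slack ≡ K → e + slack ≡ N → Extremal

Slack⇒≤∸ : ∀ {e N K} {Extremal : Set} → Slack e N K Extremal → (Extremal → e ≡ N ∸ K) →
           e ≤ N ∸ K × (e ≡ N ∸ K ⇔ Extremal)
Slack⇒≤∸ {e} {N} {K} {Extremal} σ extremal⇒e≡N∸K = e≤N∸K , mk⇔ e≡N∸K⇒extremal extremal⇒e≡N∸K
  where
  open Slack σ
  e+K≤N : e + K ≤ N
  e+K≤N = ≤-trans (+-monoʳ-≤ e minimal) bound
  e≤N∸K : e ≤ N ∸ K
  e≤N∸K = m+n≤o⇒m≤o∸n e e+K≤N
  e≡N∸K⇒extremal : e ≡ N ∸ K → Extremal
  e≡N∸K⇒extremal e≡N∸K = tight slack≡K (trans (cong (e +_) slack≡K) e+K≡N)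
    where
    e+K≡N : e + K ≡ N
    e+K≡N = trans (cong (_+ K) e≡N∸K) (m∸n+n≡m (≤-trans (m≤n+m K e) e+K≤N))
    slack≡K : slack ≡ K
    slack≡K = ≤-antisym (+-cancelˡ-≤ e slack K (subst (e + slack ≤_) (sym e+K≡N) bound)) minimal

Slack-ᵀ : ∀ {p q K} {Extremal : Set} {G : Bip p q} →
          Slack (edges (G ᵀ)) (q * p) K Extremal → Slack (edges G) (p * q) K Extremal
Slack-ᵀ {p} {q} {G = G} σ = record
  { slack   = slack
  ; bound   = subst₂ (λ e N → e + slack ≤ N) (edges-ᵀ G) (*-comm q p) bound
  ; minimal = minimal
  ; tight   = λ slack≡K e+slack≡pq →
      tight slack≡K (trans (cong (_+ slack) (edges-ᵀ G)) (trans e+slack≡pq (*-comm p q)))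
  }
  where open Slack σ

Nbr : ∀ {p q} → Bip p q → (Fin p → Bool) → Fin q → Bool
Nbr G S y = anyFin (λ x → S x ∧ G x y)

module Deficiency {p q} (G : Bip p q) (S : Fin p → Bool) where

  T : Fin q → Bool
  T = Nbr G S

  s s′ t u : ℕ
  s  = count S
  s′ = count (not ∘ S)
  t  = count T
  u  = count (not ∘ T)

  s+s′≡p : s + s′ ≡ p
  s+s′≡p = count+count-not S

  t+u≡q : t + u ≡ q
  t+u≡q = count+count-not T

  private
    T-intro : ∀ {x} y → S x ≡ true → G x y ≡ true → T y ≡ true
    T-intro {x} y Sx Gxy = anyFin-true (λ x′ → S x′ ∧ G x′ y) x (cong₂ _∧_ Sx Gxy)

    row≤ : ∀ x → count (G x) + b2n (S x) * u ≤ q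
    row≤ x with S x in Sx
    ... | true  = subst₂ _≤_ (cong (count (G x) +_) (sym (+-identityʳ u))) t+u≡q
                             (+-monoˡ-≤ u (count-mono λ y → T-intro y Sx))
    ... | false = subst (_≤ q) (sym (+-identityʳ _)) (count≤n (G x))

    ∑rows : sumFin (λ x → count (G x) + b2n (S x) * u) ≡ edges G + s * u
    ∑rows = trans (sumFin-distrib-+ (count ∘ G) (λ x → b2n (S x) * u))
                  (cong (edges G +_) (sumFin-distribʳ-* (b2n ∘ S) u))

  edges+su≤pq : edges G + s * u ≤ p * q
  edges+su≤pq = subst₂ _≤_ ∑rows (sumFin-const p q) (sumFin-mono-≤ row≤)

  edges+su≡pq⇒∨-shaped : edges G + s * u ≡ p * q → ∀ x y → G x y ≡ not (S x) ∨ T y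
  edges+su≡pq⇒∨-shaped e+su≡pq x
    with sumFin-mono-≤-≡ row≤ (trans ∑rows (trans e+su≡pq (sym (sumFin-const p q)))) x
  ... | row≡q with S x in Sx
  ... | true  = count-mono-≡ (λ y → T-intro y Sx)
                  (+-cancelʳ-≡ u (count (G x)) t
                    (trans (cong (count (G x) +_) (sym (+-identityʳ u))) (trans row≡q (sym t+u≡q))))
  ... | false = count≡n⇒true (G x) (trans (sym (+-identityʳ _)) row≡q)

  edges+su≡pq⇒≅D : edges G + s * u ≡ p * q → G ≅ D s′ s t u
  edges+su≡pq⇒≅D e+su≡pq =
    ≅-D-cong (∨-shaped⇒≅D (edges+su≡pq⇒∨-shaped e+su≡pq)) refl (count-not-not S) refl refl

  toSlack : ∀ {K} {Extremal : Set} → K ≤ s * u → (s * u ≡ K → G ≅ D s′ s t u → Extremal) →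
            Slack (edges G) (p * q) K Extremal
  toSlack K≤su extremal = record
    { slack   = s * u
    ; bound   = edges+su≤pq
    ; minimal = K≤su
    ; tight   = λ su≡K e+su≡pq → extremal su≡K (edges+su≡pq⇒≅D e+su≡pq)
    }

  t≥1 : (∀ x → ∃ λ y → G x y ≡ true) → 1 ≤ s → 1 ≤ t
  t≥1 rows s≥1 =
    let x , Sx = count≥1⇒true S s≥1
        y , Gxy = rows x
    in true⇒count≥1 T y (T-intro y Sx Gxy)

  s′≥1 : (∀ y → ∃ λ x → G x y ≡ true) → 1 ≤ u → 1 ≤ s′
  s′≥1 columns u≥1 with count≥1⇒true (not ∘ T) u≥1
  ... | y , ¬Ty with columns y
  ... | x , Gxy with S x in Sx
  ... | false = true⇒count≥1 (not ∘ S) x (cong not Sx)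
  ... | true  = ⊥-elim (not-true≢true (T-intro y Sx Gxy) ¬Ty)
    where
    not-true≢true : ∀ {b} → b ≡ true → not b ≡ true → ⊥
    not-true≢true refl ()

BadSet : ∀ {p q} → Bip p q → ℕ → Set
BadSet {p} G r = Σ[ S ∈ (Fin p → Bool) ] r * count (Nbr G S) < count S

*-+-<-split : ∀ r a b c d → r * (a + b) < c + d → r * a < c ⊎ r * b < d
*-+-<-split r a b c d r[a+b]<c+d with r * a <? c | r * b <? d
... | yes ra<c | _        = inj₁ ra<c
... | no  _    | yes rb<d = inj₂ rb<d
... | no  ra≮c | no  rb≮d = ⊥-elim (<-irrefl refl (<-≤-trans r[a+b]<c+d (begin
  c + d           ≤⟨ +-mono-≤ (≮⇒≥ ra≮c) (≮⇒≥ rb≮d) ⟩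
  r * a + r * b   ≡⟨ *-distribˡ-+ r a b ⟨
  r * (a + b)     ∎)))
  where open ≤-Reasoning

badSet-side : ∀ {p q} r (G : Bip p q) → BindingLessThanInv G r → BadSet G r ⊎ BadSet (G ᵀ) r
badSet-side {p} {q} r G (S , _ , r*|N[S]|<|S|) =
  Sum.map (SX ,_) (SY ,_)
    (*-+-<-split r _ _ (count SX) (count SY) (subst (λ n → r * n < size S) |N[S]|≡ r*|N[S]|<|S|))
  where
  SX : Fin p → Bool
  SX x = S (inj₁ x)
  SY : Fin q → Bool
  SY y = S (inj₂ y)
  |N[S]|≡ : size (nbhd G S) ≡ count (Nbr G SX) + count (Nbr (G ᵀ) SY)
  |N[S]|≡ = trans (cong₂ _+_
    (count-cong λ x → cong (_∨ Nbr (G ᵀ) SY x) (anyFin-false _ λ x′ → ∧-zeroʳ (SX x′)))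
    (count-cong λ y → trans (cong (Nbr G SX y ∨_) (anyFin-false _ λ y′ → ∧-zeroʳ (SY y′))) (∨-identityʳ _)))
    (+-comm (count (Nbr (G ᵀ) SY)) (count (Nbr G SX)))

-- Arithmetic of the three ranges

m+n≡m⇒n≡0 : ∀ m {n} → m + n ≡ m → n ≡ 0
m+n≡m⇒n≡0 m m+n≡m = +-cancelˡ-≡ m _ 0 (trans m+n≡m (sym (+-identityʳ m)))

+-≤-pred : ∀ {m n o} → 1 ≤ n → m + n ≤ o + 1 → m ≤ o
+-≤-pred {m} {n} {o} n≥1 m+n≤o+1 = +-cancelʳ-≤ 1 m o (≤-trans (+-monoʳ-≤ m n≥1) m+n≤o+1)

m+n+o∸m∸n≡o : ∀ m n o → m + n + o ∸ m ∸ n ≡ o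
m+n+o∸m∸n≡o m n o = trans (∸-+-assoc (m + n + o) m n) (m+n∸m≡n (m + n) o)

-- With t = a + 1, u = b + 1 and s = r·t + 1 + k, the product s·u exceeds r·(q − 1) + 1 by
-- r·a·b + b + k·u, which vanishes only for b = k = 0.
boundII : ∀ {r s t u n} → t + u ≡ suc n → 1 ≤ t → r * t < s → s ≤ r * suc n →
          r * n + 1 ≤ s * u × (s * u ≡ r * n + 1 → u ≡ 1 × s ≡ r * n + 1)
boundII {r} {s} {suc a} {zero} refl _ rt<s s≤rq =
  ⊥-elim (<-irrefl refl (<-≤-trans rt<s (subst (λ m → s ≤ r * suc m) (+-identityʳ a) s≤rq)))
boundII {r} {t = suc a} {suc b} refl _ rt<s _ with m≤n⇒∃[o]m+o≡n rt<s
... | k , refl = subst (r * (a + suc b) + 1 ≤_) (sym (split r a b k)) (m≤m+n _ _) , equality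
  where
  split : ∀ r a b k →
          (suc (r * suc a) + k) * suc b ≡ r * (a + suc b) + 1 + (r * a * b + b + k * suc b)
  split = solve-∀
  equality : (suc (r * suc a) + k) * suc b ≡ r * (a + suc b) + 1 →
             suc b ≡ 1 × suc (r * suc a) + k ≡ r * (a + suc b) + 1
  equality su≡K with m+n≡m⇒n≡0 (r * (a + suc b) + 1) (trans (sym (split r a b k)) su≡K)
  ... | excess≡0 with m+n≡0⇒n≡0 (r * a * b) (m+n≡0⇒m≡0 (r * a * b + b) excess≡0)
                   | m*n≡0⇒m≡0 k (suc b) (m+n≡0⇒n≡0 (r * a * b + b) excess≡0)
  ... | refl | refl = refl , s≡ r a
    where
    s≡ : ∀ r a → suc (r * suc a) + 0 ≡ r * (a + 1) + 1
    s≡ = solve-∀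

boundII-ᵀ : ∀ {r s t u} → 1 ≤ r → r * t < s → s ≤ t + u → t + u ≤ s * u
boundII-ᵀ {r@(suc _)} {s} {t} {zero} _ rt<s s≤t+u =
  ⊥-elim (<-irrefl refl (<-≤-trans (≤-<-trans (m≤n*m t r) rt<s) (subst (s ≤_) (+-identityʳ t) s≤t+u)))
boundII-ᵀ {r@(suc _)} {s} {t} {suc b} _ rt<s _ = begin
  t + suc b        ≡⟨ +-comm t (suc b) ⟩
  suc b + t        ≤⟨ +-monoʳ-≤ (suc b) (m≤m*n t (suc b)) ⟩
  suc b + t * suc b ≡⟨⟩
  suc t * suc b    ≤⟨ *-monoˡ-≤ (suc b) (≤-<-trans (m≤n*m t r) rt<s) ⟩
  s * suc b        ∎
  where open ≤-Reasoning

boundIII-u≥1 : ∀ {r s t u n} → 1 ≤ r → t + u ≡ suc n → r * t < s → s ≤ r * n + 1 → 1 ≤ u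
boundIII-u≥1 {r} {s} {t} {zero} {n} r≥1 t+0≡q rt<s s≤rn+1 =
  ⊥-elim (<-irrefl refl (<-≤-trans rt<s (begin
  s               ≤⟨ s≤rn+1 ⟩
  r * n + 1       ≡⟨ +-comm (r * n) 1 ⟩
  1 + r * n       ≤⟨ +-monoˡ-≤ (r * n) r≥1 ⟩
  r + r * n       ≡⟨ *-suc r n ⟨
  r * suc n       ≡⟨ cong (r *_) (trans (sym (+-identityʳ t)) t+0≡q) ⟨
  r * t           ∎)))
  where open ≤-Reasoning
boundIII-u≥1 {u = suc _} _ _ _ _ = s≤s z≤n

-- Here u ≤ 1 contradicts s ≤ r·(q − 1).  With t = a + 1, u = b + 2, r = r′ + 1 and
-- s = r·t + 1 + k, the product s·u exceeds (r + 1)·(q − 1) by a·(r′ + r·b) + k·u.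
boundIII : ∀ {r s t u n} → t + u ≡ suc n → 1 ≤ t → r * t < s → s ≤ r * n →
           (r + 1) * n ≤ s * u × (s * u ≡ (r + 1) * n → s ≡ r * t + 1 × (t ≡ 1 ⊎ r ≡ 1 × u ≡ 2))
boundIII {zero} _ _ 0<s s≤0 = ⊥-elim (<-irrefl refl (<-≤-trans 0<s s≤0))
boundIII {r@(suc _)} {s} {suc a} {zero} refl _ rt<s s≤rn =
  ⊥-elim (<-irrefl refl (<-≤-trans rt<s (≤-trans s≤rn (*-monoʳ-≤ r a+0≤1+a))))
  where
  a+0≤1+a : a + 0 ≤ suc a
  a+0≤1+a = ≤-trans (≤-reflexive (+-identityʳ a)) (n≤1+n a)
boundIII {r@(suc _)} {s} {suc a} {suc zero} refl _ rt<s s≤rn =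
  ⊥-elim (<-irrefl refl (<-≤-trans rt<s (subst (λ m → s ≤ r * m) (+-comm a 1) s≤rn)))
boundIII {suc r′} {t = suc a} {suc (suc b)} refl _ rt<s _ with m≤n⇒∃[o]m+o≡n rt<s
... | k , refl = subst ((suc r′ + 1) * (a + suc (suc b)) ≤_) (sym (split r′ a b k)) (m≤m+n _ _)
               , equality
  where
  split : ∀ r′ a b k → (suc (suc r′ * suc a) + k) * suc (suc b)
                       ≡ (suc r′ + 1) * (a + suc (suc b)) + (r′ * a + suc r′ * a * b + k * suc (suc b))
  split = solve-∀
  s≡ : ∀ r′ a → suc (suc r′ * suc a) + 0 ≡ suc r′ * suc a + 1
  s≡ = solve-∀
  equality : (suc (suc r′ * suc a) + k) * suc (suc b) ≡ (suc r′ + 1) * (a + suc (suc b)) →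
             suc (suc r′ * suc a) + k ≡ suc r′ * suc a + 1 × (suc a ≡ 1 ⊎ suc r′ ≡ 1 × suc (suc b) ≡ 2)
  equality su≡K with m+n≡m⇒n≡0 ((suc r′ + 1) * (a + suc (suc b))) (trans (sym (split r′ a b k)) su≡K)
  ... | excess≡0 with m*n≡0⇒m≡0 k (suc (suc b)) (m+n≡0⇒n≡0 (r′ * a + suc r′ * a * b) excess≡0)
  ... | refl = s≡ r′ a , t≡1⊎r≡1×u≡2 a (m+n≡0⇒m≡0 (r′ * a + suc r′ * a * b) excess≡0)
    where
    t≡1⊎r≡1×u≡2 : ∀ a → r′ * a + suc r′ * a * b ≡ 0 → suc a ≡ 1 ⊎ suc r′ ≡ 1 × suc (suc b) ≡ 2
    t≡1⊎r≡1×u≡2 zero    _ = inj₁ refl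
    t≡1⊎r≡1×u≡2 (suc a) e with m*n≡0⇒m≡0 r′ (suc a) (m+n≡0⇒m≡0 (r′ * suc a) e)
                             | m*n≡0⇒m≡0∨n≡0 (suc r′ * suc a) (m+n≡0⇒n≡0 (r′ * suc a) e)
    ... | refl | inj₂ refl = inj₂ (refl , refl)

parametersII : ∀ {r p s s′ t u n} → s + s′ ≡ p → t + u ≡ suc n → u ≡ 1 → s ≡ r * n + 1 →
               s′ ≡ p ∸ r * n ∸ 1 × t ≡ n
parametersII {r} {s′ = s′} {t} {n = n} refl t+1≡q refl refl =
  sym (m+n+o∸m∸n≡o (r * n) 1 s′) , suc-injective (trans (+-comm 1 t) t+1≡q)

parametersIII : ∀ {r p s s′ t u n} → s + s′ ≡ p → t + u ≡ suc n → p ≤ r * n + 1 → 1 ≤ s′ →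
                s ≡ r * t + 1 → t ≡ 1 ⊎ r ≡ 1 × u ≡ 2 →
                (s′ ≡ p ∸ r ∸ 1 × s ≡ r + 1 × t ≡ 1 × u ≡ n) ⊎ (t ≡ p ∸ r ∸ 1 × u ≡ r + 1 × s′ ≡ 1 × s ≡ n)
parametersIII {r} {s′ = s′} refl 1+u≡q _ _ refl (inj₁ refl) = inj₁
  ( sym (trans (cong (λ m → m + 1 + s′ ∸ r ∸ 1) (*-identityʳ r)) (m+n+o∸m∸n≡o r 1 s′))
  , cong (_+ 1) (*-identityʳ r) , refl , suc-injective 1+u≡q )
parametersIII {s′ = s′} {t} refl t+2≡q p≤n+1 s′≥1 refl (inj₂ (refl , refl))
  with suc-injective (trans (sym (+-suc t 1)) t+2≡q)
... | refl = inj₂ ( subst (λ m → t ≡ 1 * t + 1 + m ∸ 1 ∸ 1) (sym s′≡1) t≡t+2∸1∸1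
                 , refl , s′≡1 , cong (_+ 1) (*-identityˡ t) )
  where
  lhs : ∀ t s′ → 1 * t + 1 + s′ ≡ t + 1 + s′
  lhs = solve-∀
  rhs : ∀ t → 1 * (t + 1) + 1 ≡ t + 1 + 1
  rhs = solve-∀
  s′≡1 : s′ ≡ 1
  s′≡1 = ≤-antisym (+-cancelˡ-≤ (t + 1) s′ 1 (subst₂ _≤_ (lhs t s′) (rhs t) p≤n+1)) s′≥1
  t≡t+2∸1∸1 : t ≡ 1 * t + 1 + 1 ∸ 1 ∸ 1
  t≡t+2∸1∸1 = sym (trans (cong (λ m → m + 1 + 1 ∸ 1 ∸ 1) (*-identityˡ t))
                         (trans (cong (_∸ 1) (m+n∸n≡m (t + 1) 1)) (m+n∸n≡m t 1)))

≅D-parametersIII : ∀ {m n a b c d a′ b′ n′} {G : Bip m n} → G ≅ D a b c d →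
                   (a ≡ a′ × b ≡ b′ × c ≡ 1 × d ≡ n′) ⊎ (c ≡ a′ × d ≡ b′ × a ≡ 1 × b ≡ n′) →
                   G ≅ D a′ b′ 1 n′
≅D-parametersIII G≅D (inj₁ (a≡ , b≡ , c≡ , d≡)) = ≅-D-cong G≅D a≡ b≡ c≡ d≡
≅D-parametersIII {a′ = a′} {b′} {n′} G≅D (inj₂ (c≡ , d≡ , a≡ , b≡)) =
  ≅-trans (≅-D-cong G≅D a≡ b≡ c≡ d≡) (D-swap {1} {n′} {a′} {b′})

ExtremalII : ∀ {p q′} → ℕ → Bip p (suc q′) → Set
ExtremalII {p} {q′} r G = G ≅ D (p ∸ r * q′ ∸ 1) (r * q′ + 1) q′ 1

ExtremalIII : ∀ {p q′} → ℕ → Bip p (suc q′) → Set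
ExtremalIII {p} {q′} r G = G ≅ D (p ∸ r ∸ 1) (r + 1) 1 q′

slackII-X : ∀ r {p q′} (G : Bip p (suc q′)) → p ≤ r * suc q′ → NoIsolated G → BadSet G r →
            Slack (edges G) (p * suc q′) (r * q′ + 1) (ExtremalII r G)
slackII-X r {p} {q′} G p≤rq (rows , _) (S , rt<s) = toSlack (proj₁ bound) extremal
  where
  open Deficiency G S
  bound : r * q′ + 1 ≤ s * u × (s * u ≡ r * q′ + 1 → u ≡ 1 × s ≡ r * q′ + 1)
  bound = boundII {r} t+u≡q (t≥1 rows (≤-trans (s≤s z≤n) rt<s)) rt<s
                  (≤-trans (m≤m+n s s′) (subst (_≤ r * suc q′) (sym s+s′≡p) p≤rq))
  extremal : s * u ≡ r * q′ + 1 → G ≅ D s′ s t u → ExtremalII r G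
  extremal su≡K G≅D =
    let u≡1 , s≡K = proj₂ bound su≡K
        s′≡ , t≡q′ = parametersII {r} s+s′≡p t+u≡q u≡1 s≡K
    in ≅-D-cong G≅D s′≡ s≡K t≡q′ u≡1

-- The slack s·u is at least p > r(q − 1) + 1, so the extremal case cannot arise on this side.
slackII-ᵀ : ∀ r {p q′} (G : Bip p (suc q′)) → 1 ≤ r → suc q′ ≤ p → r * q′ + 2 ≤ p → BadSet (G ᵀ) r →
            Slack (edges G) (p * suc q′) (r * q′ + 1) (ExtremalII r G)
slackII-ᵀ r {p} {q′} G r≥1 q≤p rq′+2≤p (S , rt<s) =
  Slack-ᵀ {G = G} (toSlack {K = r * q′ + 1} {ExtremalII r G} (<⇒≤ K<su)
                           λ su≡K _ → ⊥-elim (<-irrefl (sym su≡K) K<su))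
  where
  open Deficiency (G ᵀ) S
  s≤t+u : s ≤ t + u
  s≤t+u = ≤-trans (m≤m+n s s′) (subst₂ _≤_ (sym s+s′≡p) (sym t+u≡q) q≤p)
  K<su : r * q′ + 1 < s * u
  K<su = <-≤-trans (subst (_≤ p) (+-suc (r * q′) 1) rq′+2≤p)
                   (subst (_≤ s * u) t+u≡q (boundII-ᵀ r≥1 rt<s s≤t+u))

slackIII-X : ∀ r {p q′} (G : Bip p (suc q′)) → 1 ≤ r → p ≤ r * q′ + 1 → NoIsolated G → BadSet G r →
             Slack (edges G) (p * suc q′) ((r + 1) * q′) (ExtremalIII r G)
slackIII-X r {p} {q′} G r≥1 p≤rq′+1 (rows , columns) (S , rt<s) = toSlack (proj₁ bound) extremal
  where
  open Deficiency G S
  s+s′≤rq′+1 : s + s′ ≤ r * q′ + 1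
  s+s′≤rq′+1 = subst (_≤ r * q′ + 1) (sym s+s′≡p) p≤rq′+1
  u≥1 : 1 ≤ u
  u≥1 = boundIII-u≥1 r≥1 t+u≡q rt<s (≤-trans (m≤m+n s s′) s+s′≤rq′+1)
  bound : (r + 1) * q′ ≤ s * u × (s * u ≡ (r + 1) * q′ → s ≡ r * t + 1 × (t ≡ 1 ⊎ r ≡ 1 × u ≡ 2))
  bound = boundIII {r} t+u≡q (t≥1 rows (≤-trans (s≤s z≤n) rt<s)) rt<s
                   (+-≤-pred (s′≥1 columns u≥1) s+s′≤rq′+1)
  extremal : s * u ≡ (r + 1) * q′ → G ≅ D s′ s t u → ExtremalIII r G
  extremal su≡K G≅D =
    let s≡ , shape = proj₂ bound su≡K
    in ≅D-parametersIII G≅D (parametersIII s+s′≡p t+u≡q p≤rq′+1 (s′≥1 columns u≥1) s≡ shape)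

-- On this side t + u = p, so the bound for range (iii) is applied to v = q − t ≤ u instead;
-- equality forces v = u, that is p = q, and the parameters are read off as for S ⊆ X.
slackIII-ᵀ : ∀ r {p q′} (G : Bip p (suc q′)) → 1 ≤ r → suc q′ ≤ p → p ≤ r * q′ + 1 → NoIsolated G →
             BadSet (G ᵀ) r → Slack (edges G) (p * suc q′) ((r + 1) * q′) (ExtremalIII r G)
slackIII-ᵀ r {p} {q′} G r≥1 q≤p p≤rq′+1 (columns , rows) (S , rt<s) =
  Slack-ᵀ {G = G} (toSlack {K = (r + 1) * q′} {ExtremalIII r G} (≤-trans (proj₁ bound) sv≤su) extremal)
  where
  open Deficiency (G ᵀ) S
  s≥1 : 1 ≤ s
  s≥1 = ≤-trans (s≤s z≤n) rt<s
  t<s : t < s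
  t<s = ≤-<-trans (m≤n*m t r {{>-nonZero r≥1}}) rt<s
  s≤q : s ≤ suc q′
  s≤q = subst (s ≤_) s+s′≡p (m≤m+n s s′)
  q≤t+u : suc q′ ≤ t + u
  q≤t+u = subst (suc q′ ≤_) (sym t+u≡q) q≤p
  u≥1 : 1 ≤ u
  u≥1 = +-cancelˡ-≤ t 1 u (subst (_≤ t + u) (+-comm 1 t) (≤-trans t<s (≤-trans s≤q q≤t+u)))
  v : ℕ
  v = suc q′ ∸ t
  t+v≡q : t + v ≡ suc q′
  t+v≡q = m+[n∸m]≡n (≤-trans (<⇒≤ t<s) s≤q)
  sv≤su : s * v ≤ s * u
  sv≤su = *-monoʳ-≤ s (+-cancelˡ-≤ t v u (subst (_≤ t + u) (sym t+v≡q) q≤t+u))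
  bound : (r + 1) * q′ ≤ s * v × (s * v ≡ (r + 1) * q′ → s ≡ r * t + 1 × (t ≡ 1 ⊎ r ≡ 1 × v ≡ 2))
  bound = boundIII {r} t+v≡q (t≥1 rows s≥1) rt<s
                   (+-≤-pred (s′≥1 columns u≥1) (subst (_≤ r * q′ + 1) (sym s+s′≡p) (≤-trans q≤p p≤rq′+1)))
  extremal : s * u ≡ (r + 1) * q′ → G ᵀ ≅ D s′ s t u → ExtremalIII r G
  extremal su≡K Gᵀ≅D =
    ≅D-parametersIII (≅-trans ≅-ᵀ Gᵀ≅D)
      (parametersIII (trans s+s′≡p (sym p≡q)) (trans t+u≡q p≡q) p≤rq′+1 (s′≥1 columns u≥1) s≡ shape)
    where
    sv≡su : s * v ≡ s * u
    sv≡su = ≤-antisym sv≤su (subst (_≤ s * v) (sym su≡K) (proj₁ bound))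
    v≡u : v ≡ u
    v≡u = *-cancelˡ-≡ v u s {{>-nonZero s≥1}} sv≡su
    p≡q : p ≡ suc q′
    p≡q = trans (sym t+u≡q) (trans (cong (t +_) (sym v≡u)) t+v≡q)
    s≡ : s ≡ r * t + 1
    s≡ = proj₁ (proj₂ bound (trans sv≡su su≡K))
    shape : t ≡ 1 ⊎ r ≡ 1 × u ≡ 2
    shape = Sum.map₂ (Product.map₂ (trans (sym v≡u))) (proj₂ (proj₂ bound (trans sv≡su su≡K)))

lemma3p3 : (r p q : ℕ) → 1 ≤ r → 1 ≤ q → q ≤ p →
    (G : Bip p q) → NoIsolated G → BindingLessThanInv G r →
      (r * q + 1 ≤ p →
        (edges G ≤ p * q) × ((edges G ≡ p * q) ⇔ (G ≅ K p q)))
    × (r * (q ∸ 1) + 2 ≤ p → p ≤ r * q →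
        (edges G ≤ p * q ∸ r * (q ∸ 1) ∸ 1)
        × ((edges G ≡ p * q ∸ r * (q ∸ 1) ∸ 1)
           ⇔ (G ≅ D (p ∸ r * (q ∸ 1) ∸ 1) (r * (q ∸ 1) + 1) (q ∸ 1) 1)))
    × (p ≤ r * (q ∸ 1) + 1 →
        (edges G ≤ p * q ∸ (r + 1) * (q ∸ 1))
        × ((edges G ≡ p * q ∸ (r + 1) * (q ∸ 1))
           ⇔ (G ≅ D (p ∸ r ∸ 1) (r + 1) 1 (q ∸ 1))))
lemma3p3 _ _ zero _ () _ _ _ _
lemma3p3 r p (suc q′) r≥1 _ q≤p G noIsolated b<1/r = partI , partII , partIII
  where
  side : BadSet G r ⊎ BadSet (G ᵀ) r
  side = badSet-side r G b<1/r
  partI : r * suc q′ + 1 ≤ p → edges G ≤ p * suc q′ × (edges G ≡ p * suc q′ ⇔ G ≅ K p (suc q′))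
  partI _ = edges≤* G , edges≡*⇔≅K G
  partII : r * q′ + 2 ≤ p → p ≤ r * suc q′ →
           edges G ≤ p * suc q′ ∸ r * q′ ∸ 1 × (edges G ≡ p * suc q′ ∸ r * q′ ∸ 1 ⇔ ExtremalII r G)
  partII lower upper =
    subst (λ N → edges G ≤ N × (edges G ≡ N ⇔ ExtremalII r G)) (sym (∸-+-assoc (p * suc q′) (r * q′) 1))
      (Slack⇒≤∸ ([ slackII-X r G upper noIsolated , slackII-ᵀ r G r≥1 q≤p lower ]′ side) λ G≅D →
         trans (≅D⇒edges (p ∸ r * q′ ∸ 1) (r * q′ + 1) q′ 1 G≅D (+-comm q′ 1))
               (cong (p * suc q′ ∸_) (*-identityʳ (r * q′ + 1))))
  partIII : p ≤ r * q′ + 1 →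
            edges G ≤ p * suc q′ ∸ (r + 1) * q′ × (edges G ≡ p * suc q′ ∸ (r + 1) * q′ ⇔ ExtremalIII r G)
  partIII upper =
    Slack⇒≤∸ ([ slackIII-X r G r≥1 upper noIsolated , slackIII-ᵀ r G r≥1 q≤p upper noIsolated ]′ side)
      λ G≅D → ≅D⇒edges (p ∸ r ∸ 1) (r + 1) 1 q′ G≅D refl
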